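{- Let $\Omega$ be a countably infinite set, $n\ge1$, $\Omega^{(n)}$ the set of ordered $n$-tuples of pairwise distinct elements of $\Omega$, with $\mathrm{Sym}(\Omega)$ acting coordinatewise. Let $\alpha=(a_1,\dots,a_n)\in\Omega^{(n)}$ and let $\mathcal{D}_F^\alpha$ be the set of finite blocks of imprimitivity for $\mathrm{Sym}(\Omega)$ in $\Omega^{(n)}$ containing $\alpha$. Then the elements of $\mathcal{D}_F^\alpha$ are exactly the sets $\alpha^H=\{h\alpha:h\in H\}$, where $H$ is a subgroup of $\mathrm{Sym}\{a_1,\dots,a_n\}$ (identified with the subgroup of $\mathrm{Sym}(\Omega)$ fixing $\Omega\setminus\{a_1,\dots,a_n\}$ pointwise).
   Context: A block of imprimitivity is an equivalence class of a $\mathrm{Sym}(\Omega)$-invariant equivalence relation on $\Omega^{(n)}$. -}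

module Defs where

open import Level using (Level; suc; zero)
open import Data.Nat using (ℕ; _≤_)
open import Data.Fin using (Fin)
open import Data.Vec using (Vec; lookup; map)
open import Data.Vec.Membership.Propositional using (_∈_)
open import Data.List using (List)
import Data.List.Membership.Propositional as L
open import Data.Product using (Σ; ∃; _×_; _,_)
open import Function using (id; _∘_)
open import Function.Bundles using (_↔_; Inverse; _⇔_)
open import Relation.Binary.PropositionalEquality using (_≡_)
open import Relation.Nullary using (¬_)

-- Ω is the countably infinite set ℕ.  Sym(Ω) = permutations (bijections) of ℕ.
Perm : Set
Perm = ℕ ↔ ℕ

Distinct : ∀ {n} → Vec ℕ n → Set
Distinct {n} v = (i j : Fin n) → lookup v i ≡ lookup v j → i ≡ j

act : ∀ {n} → Perm → Vec ℕ n → Vec ℕ n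
act g v = map (Inverse.to g) v

record IsEquivOnΩⁿ {n} (R : Vec ℕ n → Vec ℕ n → Set) : Set where
  field
    support : ∀ x y → R x y → Distinct x × Distinct y
    refl    : ∀ x → Distinct x → R x x
    sym     : ∀ x y → R x y → R y x
    trans   : ∀ x y z → R x y → R y z → R x z

Invariant : ∀ {n} → (Vec ℕ n → Vec ℕ n → Set) → Set
Invariant R = ∀ (g : Perm) x y → R x y → R (act g x) (act g y)

-- B is a block of imprimitivity: an equivalence class of a Sym(Ω)-invariant
-- equivalence relation on Ω⁽ⁿ⁾
IsBlock : ∀ {n} → (Vec ℕ n → Set) → Set₁
IsBlock {n} B =
  Σ (Vec ℕ n → Vec ℕ n → Set) λ R →
    IsEquivOnΩⁿ R × Invariant R ×
    Σ (Vec ℕ n) λ x → Distinct x × (∀ y → B y ⇔ R x y)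

IsFinite : ∀ {n} → (Vec ℕ n → Set) → Set
IsFinite {n} B = Σ (List (Vec ℕ n)) λ L → ∀ y → B y → y L.∈ L

InDFα : ∀ {n} → Vec ℕ n → (Vec ℕ n → Set) → Set₁
InDFα α B = IsBlock B × IsFinite B × B α

_≈ₚ_ : Perm → Perm → Set
g ≈ₚ h = ∀ x → Inverse.to g x ≡ Inverse.to h x

idP : Perm
idP = Function.Properties.Inverse.↔-refl
  where import Function.Properties.Inverse

compP : Perm → Perm → Perm
compP g h = Function.Properties.Inverse.↔-trans h g
  where import Function.Properties.Inverse

invP : Perm → Perm
invP g = Function.Properties.Inverse.↔-sym g
  where import Function.Properties.Inverse

record IsSubgroupOfSymα {n} (α : Vec ℕ n) (H : Perm → Set) : Set where
  field
    respects : ∀ g h → g ≈ₚ h → H g → H h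
    fixes    : ∀ h → H h → ∀ x → ¬ (x ∈ α) → Inverse.to h x ≡ x
    hasId    : H idP
    closed∘  : ∀ g h → H g → H h → H (compP g h)
    closed⁻¹ : ∀ g → H g → H (invP g)

Orbit : ∀ {n} → (Perm → Set) → Vec ℕ n → Vec ℕ n → Set
Orbit H α y = Σ Perm λ h → H h × y ≡ act h α

module Submission where

-- Let B be a finite block through α, the class of an invariant equivalence R. A permutation
-- that maps one member of B into B maps all of B into B, because it preserves R. If some
-- v ∈ B had an entry x that is not an entry of u ∈ B, the transposition of x with a point
-- beyond every entry of every member of B would fix u, hence carry v to a member of B with
-- an entry too large to occur in B. So all members of B rearrange the entries of α, and
-- B = α^H for H the permutations of {a₁,…,aₙ} sending α into B, a subgroup by the first
-- remark. Conversely, for a subgroup H, relating x to y when y rearranges the coordinates of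
-- x as some h ∈ H rearranges those of α is an invariant equivalence whose class through α
-- is α^H, which is finite because its members have their entries among those of α.

open import Defs
open import Data.Nat using (ℕ; _≤_; suc)
open import Data.Nat.Properties using (_≟_; <-irrefl)
open import Data.Fin using (Fin)
open import Data.Vec using (Vec; []; _∷_; lookup; map; tabulate; toList)
open import Data.Vec.Relation.Unary.Any using (here; there; index)
open import Data.Vec.Relation.Unary.Any.Properties using (lookup-index)
open import Data.Vec.Membership.Propositional using (_∈_)
open import Data.Vec.Membership.Propositional.Properties using (∈-lookup; ∈-map⁺; ∈-toList⁺)
open import Data.Vec.Membership.DecPropositional _≟_ using (_∈?_)
open import Data.Vec.Properties using (lookup-map; map-cong; map-id; map-∘; tabulate∘lookup; tabulate-cong)
open import Data.List using (List; [_]; cartesianProductWith; concatMap)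
import Data.List.Membership.Propositional as L
open import Data.List.Membership.Propositional.Properties using (∈-cartesianProductWith⁺; ∈-concatMap⁺)
import Data.List.Relation.Unary.Any as ListAny
import Data.List.Relation.Unary.All as ListAll
open import Data.List.Extrema.Nat using (max; xs≤max)
open import Data.Product using (Σ; _×_; _,_; proj₁; proj₂)
open import Function using (_∘_; id)
open import Function.Bundles using (_⇔_; Inverse; Injection; Equivalence; mk⇔; mk↔ₛ′)
open import Function.Properties.Inverse using (↔⇒↣)
open import Relation.Nullary using (¬_; Dec; yes; no; contradiction)
open import Relation.Binary.PropositionalEquality
  using (_≡_; _≢_; refl; sym; trans; cong; subst; module ≡-Reasoning)

private
  variable
    n : ℕ

_⊆_ : Vec ℕ n → Vec ℕ n → Set
u ⊆ v = ∀ {x} → x ∈ u → x ∈ v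

lookup-ext : {u v : Vec ℕ n} → (∀ i → lookup u i ≡ lookup v i) → u ≡ v
lookup-ext {u = u} {v} eq = begin
  u                   ≡⟨ tabulate∘lookup u ⟨
  tabulate (lookup u) ≡⟨ tabulate-cong eq ⟩
  tabulate (lookup v) ≡⟨ tabulate∘lookup v ⟩
  v                   ∎
  where open ≡-Reasoning

index-lookup : (v : Vec ℕ n) → Distinct v → ∀ i (p : lookup v i ∈ v) → index p ≡ i
index-lookup v v-distinct i p = v-distinct (index p) i (sym (lookup-index p))

to-injective : (g : Perm) → ∀ {x y} → Inverse.to g x ≡ Inverse.to g y → x ≡ y
to-injective g = Injection.injective (↔⇒↣ g)

lookup-act : (g : Perm) (v : Vec ℕ n) (i : Fin n) → lookup (act g v) i ≡ Inverse.to g (lookup v i)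
lookup-act g v i = lookup-map i (Inverse.to g) v

act-idP : (v : Vec ℕ n) → act idP v ≡ v
act-idP = map-id

act-compP : (g h : Perm) (v : Vec ℕ n) → act (compP g h) v ≡ act g (act h v)
act-compP g h = map-∘ (Inverse.to g) (Inverse.to h)

act-invP : (g : Perm) (v : Vec ℕ n) → act (invP g) (act g v) ≡ v
act-invP g v = begin
  act (invP g) (act g v)               ≡⟨ map-∘ (Inverse.from g) (Inverse.to g) v ⟨
  map (Inverse.from g ∘ Inverse.to g) v ≡⟨ map-cong (Inverse.strictlyInverseʳ g) v ⟩
  map id v                              ≡⟨ map-id v ⟩
  v                                     ∎
  where open ≡-Reasoning

act-cong : (g h : Perm) → g ≈ₚ h → (v : Vec ℕ n) → act g v ≡ act h v
act-cong _ _ = map-cong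

act-fixed : (g : Perm) {v : Vec ℕ n} → (∀ {x} → x ∈ v → Inverse.to g x ≡ x) → act g v ≡ v
act-fixed g {v} fixes = lookup-ext λ i → trans (lookup-act g v i) (fixes (∈-lookup i v))

act-distinct : (g : Perm) (v : Vec ℕ n) → Distinct v → Distinct (act g v)
act-distinct g v v-distinct i j eq =
  v-distinct i j (to-injective g (trans (sym (lookup-act g v i)) (trans eq (lookup-act g v j))))

FixesOutside : Vec ℕ n → Perm → Set
FixesOutside α h = ∀ x → ¬ x ∈ α → Inverse.to h x ≡ x

fixes-outside⇒maps-into : (h : Perm) {α : Vec ℕ n} →
  FixesOutside α h → ∀ {x} → x ∈ α → Inverse.to h x ∈ α
fixes-outside⇒maps-into h {α} fixes {x} x∈α with Inverse.to h x ∈? α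
... | yes hx∈α = hx∈α
... | no hx∉α = contradiction (subst (_∈ α) (sym hx≡x) x∈α) hx∉α
  where
  hx≡x : Inverse.to h x ≡ x
  hx≡x = to-injective h (fixes _ hx∉α)

transpose : ℕ → ℕ → ℕ → ℕ
transpose a b x with x ≟ a | x ≟ b
... | yes _ | _     = b
... | no _  | yes _ = a
... | no _  | no _  = x

transpose-first : ∀ a b → transpose a b a ≡ b
transpose-first a b with a ≟ a | a ≟ b
... | yes _   | _ = refl
... | no a≢a  | _ = contradiction refl a≢a

transpose-second : ∀ a b → transpose a b b ≡ a
transpose-second a b with b ≟ a | b ≟ b
... | yes b≡a | _      = b≡a
... | no _    | yes _  = refl
... | no _    | no b≢b = contradiction refl b≢b

transpose-other : ∀ {a b x} → x ≢ a → x ≢ b → transpose a b x ≡ x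
transpose-other {a} {b} {x} x≢a x≢b with x ≟ a | x ≟ b
... | yes x≡a | _       = contradiction x≡a x≢a
... | no _    | yes x≡b = contradiction x≡b x≢b
... | no _    | no _    = refl

transpose-involutive : ∀ a b x → transpose a b (transpose a b x) ≡ x
transpose-involutive a b x = by-cases (x ≟ a) (x ≟ b)
  where
  open ≡-Reasoning
  by-cases : Dec (x ≡ a) → Dec (x ≡ b) → transpose a b (transpose a b x) ≡ x
  by-cases (yes x≡a) _ = begin
    transpose a b (transpose a b x) ≡⟨ cong (transpose a b ∘ transpose a b) x≡a ⟩
    transpose a b (transpose a b a) ≡⟨ cong (transpose a b) (transpose-first a b) ⟩
    transpose a b b                 ≡⟨ transpose-second a b ⟩
    a                               ≡⟨ x≡a ⟨
    x                               ∎
  by-cases (no _) (yes x≡b) = begin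
    transpose a b (transpose a b x) ≡⟨ cong (transpose a b ∘ transpose a b) x≡b ⟩
    transpose a b (transpose a b b) ≡⟨ cong (transpose a b) (transpose-second a b) ⟩
    transpose a b a                 ≡⟨ transpose-first a b ⟩
    b                               ≡⟨ x≡b ⟨
    x                               ∎
  by-cases (no x≢a) (no x≢b) =
    trans (cong (transpose a b) (transpose-other x≢a x≢b)) (transpose-other x≢a x≢b)

transposeP : ℕ → ℕ → Perm
transposeP a b = mk↔ₛ′ (transpose a b) (transpose a b) (transpose-involutive a b) (transpose-involutive a b)

relabel : Vec ℕ n → Vec ℕ n → ℕ → ℕ
relabel u v x with x ∈? u
... | yes x∈u = lookup v (index x∈u)
... | no _    = x

relabel-outside : (u v : Vec ℕ n) → ∀ x → ¬ x ∈ u → relabel u v x ≡ x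
relabel-outside u v x x∉u with x ∈? u
... | yes x∈u = contradiction x∈u x∉u
... | no _    = refl

relabel-lookup : (u v : Vec ℕ n) → Distinct u → ∀ i → relabel u v (lookup u i) ≡ lookup v i
relabel-lookup u v u-distinct i with lookup u i ∈? u
... | yes p   = cong (lookup v) (index-lookup u u-distinct i p)
... | no u∉u  = contradiction (∈-lookup i u) u∉u

relabel-inverse : {u v : Vec ℕ n} → Distinct u → u ⊆ v → ∀ x → relabel u v (relabel v u x) ≡ x
relabel-inverse {u = u} {v} u-distinct u⊆v x with x ∈? v
... | yes x∈v = trans (relabel-lookup u v u-distinct (index x∈v)) (sym (lookup-index x∈v))
... | no x∉v with x ∈? u
...   | yes x∈u = contradiction (u⊆v x∈u) x∉v
...   | no _    = refl

relabelP : {u v : Vec ℕ n} → Distinct u → Distinct v → u ⊆ v → v ⊆ u → Perm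
relabelP {u = u} {v} u-distinct v-distinct u⊆v v⊆u =
  mk↔ₛ′ (relabel u v) (relabel v u) (relabel-inverse u-distinct u⊆v) (relabel-inverse v-distinct v⊆u)

act-relabelP : {u v : Vec ℕ n} (u-distinct : Distinct u) (v-distinct : Distinct v)
  (u⊆v : u ⊆ v) (v⊆u : v ⊆ u) → act (relabelP u-distinct v-distinct u⊆v v⊆u) u ≡ v
act-relabelP {u = u} {v} u-distinct _ _ _ =
  lookup-ext λ i → trans (lookup-map i (relabel u v) u) (relabel-lookup u v u-distinct i)

entryBound : List (Vec ℕ n) → ℕ
entryBound vs = max 0 (concatMap toList vs)

entry≤entryBound : ∀ {vs : List (Vec ℕ n)} {v x} → v L.∈ vs → x ∈ v → x ≤ entryBound vs
entry≤entryBound {vs = vs} v∈vs x∈v =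
  ListAll.lookup (xs≤max 0 (concatMap toList vs))
    (∈-concatMap⁺ toList (ListAny.map (λ { refl → ∈-toList⁺ x∈v }) v∈vs))

tuplesOver : List ℕ → (n : ℕ) → List (Vec ℕ n)
tuplesOver xs 0       = [ [] ]
tuplesOver xs (suc n) = cartesianProductWith _∷_ xs (tuplesOver xs n)

∈-tuplesOver : ∀ {xs} (v : Vec ℕ n) → (∀ {x} → x ∈ v → x L.∈ xs) → v L.∈ tuplesOver xs n
∈-tuplesOver []      _      = ListAny.here refl
∈-tuplesOver (x ∷ v) over =
  ∈-cartesianProductWith⁺ _∷_ (over (here refl)) (∈-tuplesOver v (over ∘ there))

module Block {B : Vec ℕ n → Set} {R : Vec ℕ n → Vec ℕ n → Set}
  (R-isEquiv : IsEquivOnΩⁿ R) (R-invariant : Invariant R)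
  {x₀ : Vec ℕ n} (B⇔R : ∀ y → B y ⇔ R x₀ y) where

  private
    module R = IsEquivOnΩⁿ R-isEquiv

  ∈B⇒R : ∀ {y} → B y → R x₀ y
  ∈B⇒R {y} = Equivalence.to (B⇔R y)

  R⇒∈B : ∀ {y} → R x₀ y → B y
  R⇒∈B {y} = Equivalence.from (B⇔R y)

  member-distinct : ∀ {y} → B y → Distinct y
  member-distinct {y} y∈B = proj₂ (R.support x₀ y (∈B⇒R y∈B))

  members-related : ∀ {u v} → B u → B v → R u v
  members-related {u} {v} u∈B v∈B = R.trans u x₀ v (R.sym x₀ u (∈B⇒R u∈B)) (∈B⇒R v∈B)

  act-preserves : (g : Perm) → ∀ {u v} → B u → B v → B (act g u) → B (act g v)
  act-preserves g {u} {v} u∈B v∈B gu∈B =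
    R⇒∈B (R.trans x₀ (act g u) (act g v) (∈B⇒R gu∈B) (R-invariant g u v (members-related u∈B v∈B)))

  fixer-preserves : (g : Perm) → ∀ {u v} → B u → B v → (∀ {x} → x ∈ u → Inverse.to g x ≡ x) → B (act g v)
  fixer-preserves g {u} u∈B v∈B fixes =
    act-preserves g u∈B v∈B (subst B (sym (act-fixed g fixes)) u∈B)

  module Finite {vs : List (Vec ℕ n)} (B⊆vs : ∀ y → B y → y L.∈ vs) where

    members-⊆ : ∀ {u v} → B u → B v → v ⊆ u
    members-⊆ {u} {v} u∈B v∈B {x} x∈v with x ∈? u
    ... | yes x∈u = x∈u
    ... | no x∉u  = contradiction (entry≤entryBound (B⊆vs _ gv∈B) c∈gv) (<-irrefl refl)
      where
      c : ℕ
      c = suc (entryBound vs)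

      g : Perm
      g = transposeP x c

      g-fixes-u : ∀ {w} → w ∈ u → Inverse.to g w ≡ w
      g-fixes-u {w} w∈u = transpose-other
        (λ { refl → x∉u w∈u })
        (λ { refl → <-irrefl refl (entry≤entryBound (B⊆vs u u∈B) w∈u) })

      gv∈B : B (act g v)
      gv∈B = fixer-preserves g u∈B v∈B g-fixes-u

      c∈gv : c ∈ act g v
      c∈gv = subst (_∈ act g v) (transpose-first x c) (∈-map⁺ (Inverse.to g) x∈v)

stabiliser : Vec ℕ n → (Vec ℕ n → Set) → Perm → Set
stabiliser α B h = FixesOutside α h × B (act h α)

finiteBlock⇒orbit : {α : Vec ℕ n} → Distinct α → (B : Vec ℕ n → Set) → InDFα α B →
  Σ (Perm → Set) (λ H → IsSubgroupOfSymα α H × (∀ y → B y ⇔ Orbit H α y))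
finiteBlock⇒orbit {α = α} α-distinct B ((R , R-isEquiv , R-invariant , _ , _ , B⇔R) , (vs , B⊆vs) , α∈B) =
  stabiliser α B , isSubgroup , B⇔orbit
  where
  open Block R-isEquiv R-invariant B⇔R
  open Finite B⊆vs

  isSubgroup : IsSubgroupOfSymα α (stabiliser α B)
  isSubgroup = record
    { respects = λ g h g≈h (g-fixes , gα∈B) →
        (λ x x∉α → trans (sym (g≈h x)) (g-fixes x x∉α)) , subst B (act-cong g h g≈h α) gα∈B
    ; fixes    = λ h → proj₁
    ; hasId    = (λ _ _ → refl) , subst B (sym (act-idP α)) α∈B
    ; closed∘  = λ g h (g-fixes , gα∈B) (h-fixes , hα∈B) →
        (λ x x∉α → trans (cong (Inverse.to g) (h-fixes x x∉α)) (g-fixes x x∉α)) ,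
        subst B (sym (act-compP g h α)) (act-preserves g α∈B hα∈B gα∈B)
    ; closed⁻¹ = λ g (g-fixes , gα∈B) →
        (λ x x∉α → trans (cong (Inverse.from g) (sym (g-fixes x x∉α))) (Inverse.strictlyInverseʳ g x)) ,
        act-preserves (invP g) gα∈B α∈B (subst B (sym (act-invP g α)) α∈B)
    }

  B⇔orbit : ∀ y → B y ⇔ Orbit (stabiliser α B) α y
  B⇔orbit y = mk⇔ to-orbit λ { (h , (_ , hα∈B) , refl) → hα∈B }
    where
    to-orbit : B y → Orbit (stabiliser α B) α y
    to-orbit y∈B = h , (relabel-outside α y , subst B (sym hα≡y) y∈B) , sym hα≡y
      where
      y-distinct : Distinct y
      y-distinct = member-distinct y∈B

      α⊆y : α ⊆ y
      α⊆y = members-⊆ y∈B α∈B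

      y⊆α : y ⊆ α
      y⊆α = members-⊆ α∈B y∈B

      h : Perm
      h = relabelP α-distinct y-distinct α⊆y y⊆α

      hα≡y : act h α ≡ y
      hα≡y = act-relabelP α-distinct y-distinct α⊆y y⊆α

module SubgroupOrbit {α : Vec ℕ n} (α-distinct : Distinct α)
  {H : Perm → Set} (H-isSubgroup : IsSubgroupOfSymα α H) where

  open IsSubgroupOfSymα H-isSubgroup

  maps-α-into-α : ∀ {h} → H h → ∀ i → Inverse.to h (lookup α i) ∈ α
  maps-α-into-α {h} h∈H i = fixes-outside⇒maps-into h (fixes h h∈H) (∈-lookup i α)

  -- hα = α ∘ π for a permutation π of the positions, and then y = x ∘ π.
  _∼_ : Vec ℕ n → Vec ℕ n → Set
  x ∼ y = Distinct x × Distinct y × Σ Perm λ h → H h ×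
    (∀ i j → Inverse.to h (lookup α i) ≡ lookup α j → lookup y i ≡ lookup x j)

  ∼-isEquiv : IsEquivOnΩⁿ _∼_
  ∼-isEquiv = record
    { support = λ { x y (x-distinct , y-distinct , _) → x-distinct , y-distinct }
    ; refl    = λ x x-distinct → x-distinct , x-distinct , idP , hasId ,
        λ i j eq → cong (lookup x) (α-distinct i j eq)
    ; sym     = λ { x y (x-distinct , y-distinct , h , h∈H , moves) →
        y-distinct , x-distinct , invP h , closed⁻¹ h h∈H , λ i j eq →
          sym (moves j i (trans (cong (Inverse.to h) (sym eq)) (Inverse.strictlyInverseˡ h _))) }
    ; trans   = λ { x y z (x-distinct , _ , h , h∈H , moves) (_ , z-distinct , h′ , h′∈H , moves′) →
        x-distinct , z-distinct , compP h h′ , closed∘ h h′ h∈H h′∈H , λ i j eq →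
          let h′αᵢ∈α = maps-α-into-α h′∈H i in
          trans (moves′ i (index h′αᵢ∈α) (lookup-index h′αᵢ∈α))
                (moves (index h′αᵢ∈α) j (trans (cong (Inverse.to h) (sym (lookup-index h′αᵢ∈α))) eq)) }
    }

  ∼-invariant : Invariant _∼_
  ∼-invariant g x y (x-distinct , y-distinct , h , h∈H , moves) =
    act-distinct g x x-distinct , act-distinct g y y-distinct , h , h∈H , λ i j eq →
      trans (lookup-act g y i) (trans (cong (Inverse.to g) (moves i j eq)) (sym (lookup-act g x j)))

  orbit⇔∼ : ∀ y → Orbit H α y ⇔ α ∼ y
  orbit⇔∼ y = mk⇔ to-∼ from-∼
    where
    to-∼ : Orbit H α y → α ∼ y
    to-∼ (h , h∈H , refl) = α-distinct , act-distinct h α α-distinct , h , h∈H ,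
      λ i j eq → trans (lookup-act h α i) eq

    from-∼ : α ∼ y → Orbit H α y
    from-∼ (_ , _ , h , h∈H , moves) = h , h∈H , lookup-ext λ i →
      let hαᵢ∈α = maps-α-into-α h∈H i in
      trans (moves i (index hαᵢ∈α) (lookup-index hαᵢ∈α))
            (trans (sym (lookup-index hαᵢ∈α)) (sym (lookup-act h α i)))

  orbit-⊆ : ∀ {y} → Orbit H α y → y ⊆ α
  orbit-⊆ (h , h∈H , refl) {x} x∈hα = subst (_∈ α) (sym x≡hαᵢ) (maps-α-into-α h∈H (index x∈hα))
    where
    x≡hαᵢ : x ≡ Inverse.to h (lookup α (index x∈hα))
    x≡hαᵢ = trans (lookup-index x∈hα) (lookup-act h α (index x∈hα))

orbit⇒finiteBlock : {α : Vec ℕ n} → Distinct α → (B : Vec ℕ n → Set) →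
  Σ (Perm → Set) (λ H → IsSubgroupOfSymα α H × (∀ y → B y ⇔ Orbit H α y)) → InDFα α B
orbit⇒finiteBlock {n = n} {α} α-distinct B (H , H-isSubgroup , B⇔orbit) =
  (_∼_ , ∼-isEquiv , ∼-invariant , α , α-distinct , B⇔∼) ,
  (tuplesOver (toList α) n , λ y y∈B → ∈-tuplesOver y (∈-toList⁺ ∘ orbit-⊆ (to-orbit y∈B))) ,
  Equivalence.from (B⇔orbit α) (idP , IsSubgroupOfSymα.hasId H-isSubgroup , sym (act-idP α))
  where
  open SubgroupOrbit α-distinct H-isSubgroup

  to-orbit : ∀ {y} → B y → Orbit H α y
  to-orbit {y} = Equivalence.to (B⇔orbit y)

  B⇔∼ : ∀ y → B y ⇔ α ∼ y
  B⇔∼ y = mk⇔ (Equivalence.to (orbit⇔∼ y) ∘ to-orbit)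
               (Equivalence.from (B⇔orbit y) ∘ Equivalence.from (orbit⇔∼ y))

proposition20 : (n : ℕ) → 1 ≤ n → (α : Vec ℕ n) → Distinct α →
    (B : Vec ℕ n → Set) →
    InDFα α B ⇔ Σ (Perm → Set) (λ H → IsSubgroupOfSymα α H × (∀ y → B y ⇔ Orbit H α y))
proposition20 n _ α α-distinct B = mk⇔ (finiteBlock⇒orbit α-distinct B) (orbit⇒finiteBlock α-distinct B)
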